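{- Let $T$ be a tournament with a receiver $t$ and no transmitter. Then $T$ is quadrangular if and only if $\gamma((T-t)^{r})>2$, $T-t$ is in-quadrangular, and $\delta^{ - }(T-t)\geq 2$.
   Context: A tournament $T$ is a loopless digraph in which for each pair of distinct vertices exactly one of $(u,v)$, $(v,u)$ is an arc; $u\rightarrow v$ means $(u,v)$ is an arc. $O(v)=\{u:v\rightarrow u\}$, $I(v)=\{u:u\rightarrow v\}$. A digraph is quadrangular if for all distinct $u,v$, $|O(u)\cap O(v)|\neq 1$ and $|I(u)\cap I(v)|\neq 1$; it is in-quadrangular if $|I(u)\cap I(v)|\neq1$ for all distinct $u,v$. A transmitter dominates all other vertices; a receiver is dominated by all other vertices. $T-t$ is the subtournament induced on $V(T)\setminus\{t\}$. The dual $T^{r}$ has the same vertices with $x\rightarrow y$ in $T^r$ iff $y\rightarrow x$ in $T$. $\delta^{ - }(D)$ is the minimum in-degree $|I(v)|$ over vertices of $D$. A dominating set of $D$ is a set $S$ of vertices such that every vertex is in $S$ or dominated by some vertex of $S$; $\gamma(D)$ is the minimum size of a dominating set. -}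

module Defs where

open import Data.Nat using (ℕ; suc; _≤_; _>_)
open import Data.Bool using (Bool; true; false; _∧_; T)
open import Data.Fin using (Fin; punchIn)
open import Data.Fin.Subset using (Subset; _∈_; ∣_∣)
open import Data.List using (List; length; filterᵇ; allFin)
open import Data.Product using (Σ; ∃; _×_)
open import Data.Sum using (_⊎_)
open import Relation.Binary.PropositionalEquality using (_≡_; _≢_)
open import Relation.Nullary using (¬_)

Digraph : ℕ → Set
Digraph n = Fin n → Fin n → Bool

_⟶[_]_ : ∀ {n} → Fin n → Digraph n → Fin n → Set
u ⟶[ D ] v = T (D u v)

record IsTournament {n : ℕ} (D : Digraph n) : Set where
  field
    loopless   : ∀ u → ¬ (u ⟶[ D ] u)
    total      : ∀ u v → u ≢ v → (u ⟶[ D ] v) ⊎ (v ⟶[ D ] u)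
    asymmetric : ∀ u v → u ⟶[ D ] v → ¬ (v ⟶[ D ] u)

count : ∀ {n} → (Fin n → Bool) → ℕ
count {n} p = length (filterᵇ p (allFin n))

commonOut : ∀ {n} → Digraph n → Fin n → Fin n → ℕ
commonOut D u v = count (λ w → D u w ∧ D v w)

commonIn : ∀ {n} → Digraph n → Fin n → Fin n → ℕ
commonIn D u v = count (λ w → D w u ∧ D w v)

inDegree : ∀ {n} → Digraph n → Fin n → ℕ
inDegree D v = count (λ w → D w v)

IsQuadrangular : ∀ {n} → Digraph n → Set
IsQuadrangular D = ∀ u v → u ≢ v → (commonOut D u v ≢ 1) × (commonIn D u v ≢ 1)

IsInQuadrangular : ∀ {n} → Digraph n → Set
IsInQuadrangular D = ∀ u v → u ≢ v → commonIn D u v ≢ 1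

IsTransmitter : ∀ {n} → Digraph n → Fin n → Set
IsTransmitter D t = ∀ u → u ≢ t → t ⟶[ D ] u

IsReceiver : ∀ {n} → Digraph n → Fin n → Set
IsReceiver D t = ∀ u → u ≢ t → u ⟶[ D ] t

deleteVertex : ∀ {n} → Digraph (suc n) → Fin (suc n) → Digraph n
deleteVertex D t i j = D (punchIn t i) (punchIn t j)

dual : ∀ {n} → Digraph n → Digraph n
dual D x y = D y x

IsDominatingSet : ∀ {n} → Digraph n → Subset n → Set
IsDominatingSet D S = ∀ v → v ∈ S ⊎ (∃ λ s → s ∈ S × s ⟶[ D ] v)

γ≤ : ∀ {n} → Digraph n → ℕ → Set
γ≤ D k = ∃ λ S → IsDominatingSet D S × ∣ S ∣ ≤ k

γ> : ∀ {n} → Digraph n → ℕ → Set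
γ> D k = ¬ γ≤ D k

δ⁻≥ : ∀ {n} → Digraph n → ℕ → Set
δ⁻≥ D k = ∀ v → k ≤ inDegree D v

{-# OPTIONS --safe #-}
-- A receiver t lies in O(u) ∩ O(v) for all u, v ≠ t, while O(t) is empty and I(t) ∩ I(v) is
-- the in-neighbourhood of v in T - t.  So for u, v ≠ t the pair condition of T says that u, v
-- have a common out-neighbour in T - t and |I(u) ∩ I(v)| ≠ 1 there, and for the pair t, v it
-- says that v does not have in-degree 1 in T - t.  In a tournament, {u, v} dominates the dual
-- exactly when u and v have no common out-neighbour, and a dominating set of size at most 2
-- lies in such a pair of distinct vertices (completed, if needed, by an in-neighbour).  A
-- vertex of in-degree 0 in T - t would be a transmitter of T.
module Submission where

open import Defs
open import Data.Nat using (ℕ; zero; suc; _+_; _≤_; _<_; z≤n; s≤s)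
open import Data.Nat.Properties
  using ( +-0-commutativeMonoid; +-suc; +-monoʳ-≤; n≤1+n; ≤-trans; ≤-reflexive; ≤-pred
        ; m<n⇒0<n; <-irrefl; ≤∧≢⇒<; n≢0⇒n>0; >⇒≢; 0≢1+n; suc-injective; module ≤-Reasoning)
open import Algebra.Properties.CommutativeMonoid.Sum +-0-commutativeMonoid
  using (sum; sum-syntax; sum-cong-≗; sum-remove; sum-replicate-zero)
open import Data.Bool using (Bool; true; false; _∧_; T)
open import Data.Bool.Properties using (∧-comm; ¬-not; T-≡; T-∧)
open import Data.Fin using (Fin; zero; suc; punchIn; punchOut; _≟_)
open import Data.Fin.Properties using (any?; punchIn-injective; punchInᵢ≢i; punchIn-punchOut)
open import Data.Fin.Subset using (Subset; inside; outside; _∈_; _⊆_; _∪_; _-_; ⁅_⁆; ∣_∣; Nonempty)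
open import Data.Fin.Subset.Properties
  using ( _∈?_; x∈⁅x⁆; x∈⁅y⁆⇒x≡y; ∣⁅x⁆∣≡1; x∈p∪q⁺; x∈p∪q⁻; x∈p∧x≢y⇒x∈p-y; x∈p⇒∣p-x∣<∣p∣)
open import Data.List using (length; filterᵇ; tabulate)
open import Data.Vec using (_∷_; [])
open import Data.Product using (∃; _×_; _,_; proj₁; proj₂; map₁; map₂)
open import Data.Sum using (_⊎_; inj₁; inj₂; [_,_]′) renaming (map to ⊎-map)
open import Function using (_∘_; id)
open import Function.Bundles using (_⇔_; mk⇔; Equivalence)
open import Relation.Nullary using (¬_; yes; no; ¬?; contradiction)
open import Relation.Nullary.Decidable using (_×-dec_; T?)
open import Relation.Binary.PropositionalEquality
  using (_≡_; _≢_; refl; sym; trans; cong; cong₂; subst; ≢-sym; module ≡-Reasoning)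

open Equivalence using (to; from)

toℕ : Bool → ℕ
toℕ false = 0
toℕ true  = 1

length-filterᵇ-tabulate : ∀ {m n} (p : Fin m → Bool) (f : Fin n → Fin m) →
                          length (filterᵇ p (tabulate f)) ≡ ∑[ i < n ] toℕ (p (f i))
length-filterᵇ-tabulate {n = zero}  p f = refl
length-filterᵇ-tabulate {n = suc n} p f with p (f zero)
... | true  = cong suc (length-filterᵇ-tabulate p (f ∘ suc))
... | false = length-filterᵇ-tabulate p (f ∘ suc)

count≡∑ : ∀ {n} (p : Fin n → Bool) → count p ≡ ∑[ i < n ] toℕ (p i)
count≡∑ p = length-filterᵇ-tabulate p id

module _ {n : ℕ} where
  open ≡-Reasoning

  count-cong : {p q : Fin n → Bool} → (∀ i → p i ≡ q i) → count p ≡ count q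
  count-cong {p} {q} p≗q = begin
    count p                 ≡⟨ count≡∑ p ⟩
    ∑[ i < n ] toℕ (p i)    ≡⟨ sum-cong-≗ (cong toℕ ∘ p≗q) ⟩
    ∑[ i < n ] toℕ (q i)    ≡⟨ count≡∑ q ⟨
    count q                 ∎

  count-none : {p : Fin n → Bool} → (∀ i → ¬ T (p i)) → count p ≡ 0
  count-none {p} ¬p = begin
    count p                ≡⟨ count≡∑ p ⟩
    ∑[ i < n ] toℕ (p i)   ≡⟨ sum-cong-≗ (λ i → cong toℕ (¬-not (¬p i ∘ from T-≡))) ⟩
    ∑[ i < n ] 0           ≡⟨ sum-replicate-zero n ⟩
    0                      ∎

count-punchIn : ∀ {n} (t : Fin (suc n)) (p : Fin (suc n) → Bool) →
                count p ≡ toℕ (p t) + count (p ∘ punchIn t)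
count-punchIn t p = begin
  count p                                  ≡⟨ count≡∑ p ⟩
  sum (toℕ ∘ p)                            ≡⟨ sum-remove {i = t} (toℕ ∘ p) ⟩
  toℕ (p t) + sum (toℕ ∘ p ∘ punchIn t)    ≡⟨ cong (toℕ (p t) +_) (count≡∑ (p ∘ punchIn t)) ⟨
  toℕ (p t) + count (p ∘ punchIn t)        ∎
  where open ≡-Reasoning

module _ {n : ℕ} (t : Fin (suc n)) (p : Fin (suc n) → Bool) where

  count-punchIn-T : T (p t) → count p ≡ suc (count (p ∘ punchIn t))
  count-punchIn-T pₜ with p t | count-punchIn t p
  ... | true | eq = eq

  count-punchIn-¬T : ¬ T (p t) → count p ≡ count (p ∘ punchIn t)
  count-punchIn-¬T ¬pₜ with p t | count-punchIn t p
  ... | true  | _  = contradiction _ ¬pₜ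
  ... | false | eq = eq

count≢0 : ∀ {n} (p : Fin n → Bool) (i : Fin n) → T (p i) → count p ≢ 0
count≢0 {suc n} p i pᵢ count≡0 = 0≢1+n (trans (sym count≡0) (count-punchIn-T i p pᵢ))

count≢0⇒∃ : ∀ {n} (p : Fin n → Bool) → count p ≢ 0 → ∃ λ i → T (p i)
count≢0⇒∃ p count≢0 with any? (λ i → T? (p i))
... | yes ∃i = ∃i
... | no  ∄i = contradiction (count-none (λ i pᵢ → ∄i (i , pᵢ))) count≢0

∣p∪q∣≤∣p∣+∣q∣ : ∀ {n} (p q : Subset n) → ∣ p ∪ q ∣ ≤ ∣ p ∣ + ∣ q ∣
∣p∪q∣≤∣p∣+∣q∣ []            []            = z≤n
∣p∪q∣≤∣p∣+∣q∣ (inside  ∷ p) (inside  ∷ q) =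
  s≤s (≤-trans (∣p∪q∣≤∣p∣+∣q∣ p q) (+-monoʳ-≤ ∣ p ∣ (n≤1+n ∣ q ∣)))
∣p∪q∣≤∣p∣+∣q∣ (inside  ∷ p) (outside ∷ q) = s≤s (∣p∪q∣≤∣p∣+∣q∣ p q)
∣p∪q∣≤∣p∣+∣q∣ (outside ∷ p) (inside  ∷ q) =
  ≤-trans (s≤s (∣p∪q∣≤∣p∣+∣q∣ p q)) (≤-reflexive (sym (+-suc ∣ p ∣ ∣ q ∣)))
∣p∪q∣≤∣p∣+∣q∣ (outside ∷ p) (outside ∷ q) = ∣p∪q∣≤∣p∣+∣q∣ p q

module _ {n : ℕ} where

  ∣⁅x⁆∪⁅y⁆∣≤2 : (x y : Fin n) → ∣ ⁅ x ⁆ ∪ ⁅ y ⁆ ∣ ≤ 2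
  ∣⁅x⁆∪⁅y⁆∣≤2 x y = ≤-trans (∣p∪q∣≤∣p∣+∣q∣ ⁅ x ⁆ ⁅ y ⁆) (≤-reflexive (cong₂ _+_ (∣⁅x⁆∣≡1 x) (∣⁅x⁆∣≡1 y)))

  ∈⁅x⁆∪⁅y⁆⁺ : {x y z : Fin n} → z ≡ x ⊎ z ≡ y → z ∈ ⁅ x ⁆ ∪ ⁅ y ⁆
  ∈⁅x⁆∪⁅y⁆⁺ (inj₁ refl) = x∈p∪q⁺ (inj₁ (x∈⁅x⁆ _))
  ∈⁅x⁆∪⁅y⁆⁺ (inj₂ refl) = x∈p∪q⁺ (inj₂ (x∈⁅x⁆ _))

  ∈⁅x⁆∪⁅y⁆⁻ : {x y z : Fin n} → z ∈ ⁅ x ⁆ ∪ ⁅ y ⁆ → z ≡ x ⊎ z ≡ y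
  ∈⁅x⁆∪⁅y⁆⁻ {x} {y} = ⊎-map (x∈⁅y⁆⇒x≡y x) (x∈⁅y⁆⇒x≡y y) ∘ x∈p∪q⁻ ⁅ x ⁆ ⁅ y ⁆

  ∣p∣≤1⇒≡ : {p : Subset n} {x y : Fin n} → ∣ p ∣ ≤ 1 → x ∈ p → y ∈ p → x ≡ y
  ∣p∣≤1⇒≡ {p} {x} {y} ∣p∣≤1 x∈p y∈p with x ≟ y
  ... | yes x≡y = x≡y
  ... | no  x≢y = contradiction 1<1 (<-irrefl refl)
    where
    open ≤-Reasoning
    1<1 : 1 < 1
    1<1 = begin-strict
      1          ≤⟨ m<n⇒0<n (x∈p⇒∣p-x∣<∣p∣ (x∈p∧x≢y⇒x∈p-y y∈p (x≢y ∘ sym))) ⟩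
      ∣ p - x ∣  <⟨ x∈p⇒∣p-x∣<∣p∣ x∈p ⟩
      ∣ p ∣      ≤⟨ ∣p∣≤1 ⟩
      1          ∎

  ⊆⁅x⁆∪⁅y⁆ : {S : Subset n} {x w : Fin n} → ∣ S ∣ ≤ 2 → x ∈ S → w ≢ x →
             ∃ λ y → y ≢ x × S ⊆ ⁅ x ⁆ ∪ ⁅ y ⁆
  ⊆⁅x⁆∪⁅y⁆ {S} {x} {w} ∣S∣≤2 x∈S w≢x with any? (λ y → (y ∈? S) ×-dec ¬? (y ≟ x))
  ... | yes (y , y∈S , y≢x) = y , y≢x , λ {z} z∈S → ∈⁅x⁆∪⁅y⁆⁺ (x-or-y z z∈S)
    where
    ∣S-x∣≤1 : ∣ S - x ∣ ≤ 1
    ∣S-x∣≤1 = ≤-pred (≤-trans (x∈p⇒∣p-x∣<∣p∣ x∈S) ∣S∣≤2)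
    x-or-y : ∀ z → z ∈ S → z ≡ x ⊎ z ≡ y
    x-or-y z z∈S with z ≟ x
    ... | yes z≡x = inj₁ z≡x
    ... | no  z≢x = inj₂ (∣p∣≤1⇒≡ ∣S-x∣≤1 (x∈p∧x≢y⇒x∈p-y z∈S z≢x) (x∈p∧x≢y⇒x∈p-y y∈S y≢x))
  ... | no ∄y = w , w≢x , λ {z} z∈S → ∈⁅x⁆∪⁅y⁆⁺ (inj₁ (only-x z z∈S))
    where
    only-x : ∀ z → z ∈ S → z ≡ x
    only-x z z∈S with z ≟ x
    ... | yes z≡x = z≡x
    ... | no  z≢x = contradiction (z , z∈S , z≢x) ∄y

module _ {n : ℕ} (D : Digraph n) where

  commonOut-comm : ∀ u v → commonOut D u v ≡ commonOut D v u
  commonOut-comm u v = count-cong (λ w → ∧-comm (D u w) (D v w))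

  commonIn-comm : ∀ u v → commonIn D u v ≡ commonIn D v u
  commonIn-comm u v = count-cong (λ w → ∧-comm (D w u) (D w v))

  QuadrangularPair : Fin n → Fin n → Set
  QuadrangularPair u v = (commonOut D u v ≢ 1) × (commonIn D u v ≢ 1)

  quadrangularPair-comm : ∀ {u v} → QuadrangularPair u v → QuadrangularPair v u
  quadrangularPair-comm {u} {v} (out≢1 , in≢1) =
    subst (_≢ 1) (commonOut-comm u v) out≢1 , subst (_≢ 1) (commonIn-comm u v) in≢1

  dominating-⊆ : ∀ {S S′} → IsDominatingSet D S → S ⊆ S′ → IsDominatingSet D S′
  dominating-⊆ dom S⊆S′ v = ⊎-map S⊆S′ (map₂ (map₁ S⊆S′)) (dom v)

  dominating-nonempty : ∀ {S} → IsDominatingSet D S → Fin n → Nonempty S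
  dominating-nonempty dom v = [ (v ,_) , map₂ proj₁ ]′ (dom v)

deleteVertex-tournament : ∀ {n} {D : Digraph (suc n)} (t : Fin (suc n)) →
                          IsTournament D → IsTournament (deleteVertex D t)
deleteVertex-tournament t tour = record
  { loopless   = loopless ∘ punchIn t
  ; total      = λ u v u≢v → total (punchIn t u) (punchIn t v) (u≢v ∘ punchIn-injective t u v)
  ; asymmetric = λ u v → asymmetric (punchIn t u) (punchIn t v)
  }
  where open IsTournament tour

module _ {n : ℕ} {D : Digraph n} (tour : IsTournament D) where
  open IsTournament tour

  receiver-¬⟶ : ∀ {t} → IsReceiver D t → ∀ u → ¬ (t ⟶[ D ] u)
  receiver-¬⟶ {t} rec u t⟶u with u ≟ t
  ... | yes refl = loopless t t⟶u
  ... | no  u≢t  = asymmetric t u t⟶u (rec u u≢t)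

  dual-dominating-pair⇔commonOut≡0 : ∀ {u v} →
    IsDominatingSet (dual D) (⁅ u ⁆ ∪ ⁅ v ⁆) ⇔ commonOut D u v ≡ 0
  dual-dominating-pair⇔commonOut≡0 {u} {v} = mk⇔ (count-none ∘ no-common-out) dominating
    where
    no-common-out : IsDominatingSet (dual D) (⁅ u ⁆ ∪ ⁅ v ⁆) → ∀ x → ¬ T (D u x ∧ D v x)
    no-common-out dom x uv⟶x =
      [ loopless x ∘ pair⟶x , (λ (s , s∈S , x⟶s) → asymmetric x s x⟶s (pair⟶x s∈S)) ]′ (dom x)
      where
      pair⟶x : ∀ {s} → s ∈ ⁅ u ⁆ ∪ ⁅ v ⁆ → s ⟶[ D ] x
      pair⟶x = [ (λ { refl → proj₁ (to T-∧ uv⟶x) }) , (λ { refl → proj₂ (to T-∧ uv⟶x) }) ]′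
             ∘ ∈⁅x⁆∪⁅y⁆⁻

    dominating : commonOut D u v ≡ 0 → IsDominatingSet (dual D) (⁅ u ⁆ ∪ ⁅ v ⁆)
    dominating out≡0 x with x ≟ u | x ≟ v
    ... | yes x≡u | _       = inj₁ (∈⁅x⁆∪⁅y⁆⁺ (inj₁ x≡u))
    ... | no  _   | yes x≡v = inj₁ (∈⁅x⁆∪⁅y⁆⁺ (inj₂ x≡v))
    ... | no  x≢u | no  x≢v with total x u x≢u | total x v x≢v
    ...   | inj₁ x⟶u | _          = inj₂ (u , ∈⁅x⁆∪⁅y⁆⁺ (inj₁ refl) , x⟶u)
    ...   | inj₂ _   | inj₁ x⟶v   = inj₂ (v , ∈⁅x⁆∪⁅y⁆⁺ (inj₂ refl) , x⟶v)
    ...   | inj₂ u⟶x | inj₂ v⟶x   =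
      contradiction out≡0 (count≢0 (λ w → D u w ∧ D v w) x (from T-∧ (u⟶x , v⟶x)))

  γ>2-dual⇒commonOut≢0 : γ> (dual D) 2 → ∀ u v → commonOut D u v ≢ 0
  γ>2-dual⇒commonOut≢0 γ>2 u v out≡0 =
    γ>2 (⁅ u ⁆ ∪ ⁅ v ⁆ , from dual-dominating-pair⇔commonOut≡0 out≡0 , ∣⁅x⁆∪⁅y⁆∣≤2 u v)

  commonOut≢0⇒γ>2-dual : Fin n → (∀ v → inDegree D v ≢ 0) →
                         (∀ u v → u ≢ v → commonOut D u v ≢ 0) → γ> (dual D) 2
  commonOut≢0⇒γ>2-dual a in≢0 out≢0 (S , dom , ∣S∣≤2)
    with dominating-nonempty (dual D) dom a
  ... | u , u∈S with count≢0⇒∃ (λ w → D w u) (in≢0 u)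
  ... | w , w⟶u with ⊆⁅x⁆∪⁅y⁆ {w = w} ∣S∣≤2 u∈S (λ { refl → loopless w w⟶u })
  ... | v , v≢u , S⊆uv =
    out≢0 u v (≢-sym v≢u) (to dual-dominating-pair⇔commonOut≡0 (dominating-⊆ (dual D) dom S⊆uv))

≡-or-punchIn : ∀ {n} (t u : Fin (suc n)) → u ≡ t ⊎ ∃ λ i → punchIn t i ≡ u
≡-or-punchIn t u with u ≟ t
... | yes u≡t = inj₁ u≡t
... | no  u≢t = inj₂ (punchOut (u≢t ∘ sym) , punchIn-punchOut (u≢t ∘ sym))

module _ {n : ℕ} {D : Digraph (suc n)} {t : Fin (suc n)}
         (tour : IsTournament D) (rec : IsReceiver D t) where
  open IsTournament tour

  private
    D′ : Digraph n
    D′ = deleteVertex D t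

    tour′ : IsTournament D′
    tour′ = deleteVertex-tournament t tour

    t↛ : ∀ u → ¬ (t ⟶[ D ] u)
    t↛ = receiver-¬⟶ tour rec

    ⟶t : ∀ i → punchIn t i ⟶[ D ] t
    ⟶t i = rec (punchIn t i) (punchInᵢ≢i t i)

  commonOut-punchIn : ∀ u v → commonOut D (punchIn t u) (punchIn t v) ≡ suc (commonOut D′ u v)
  commonOut-punchIn u v =
    count-punchIn-T t (λ w → D (punchIn t u) w ∧ D (punchIn t v) w) (from T-∧ (⟶t u , ⟶t v))

  commonIn-punchIn : ∀ u v → commonIn D (punchIn t u) (punchIn t v) ≡ commonIn D′ u v
  commonIn-punchIn u v =
    count-punchIn-¬T t (λ w → D w (punchIn t u) ∧ D w (punchIn t v)) (t↛ (punchIn t u) ∘ proj₁ ∘ to T-∧)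

  commonIn-receiver : ∀ v → commonIn D t (punchIn t v) ≡ inDegree D′ v
  commonIn-receiver v = begin
    commonIn D t (punchIn t v)                ≡⟨ count-punchIn-¬T t (λ w → D w t ∧ D w (punchIn t v))
                                                                    (t↛ t ∘ proj₁ ∘ to T-∧) ⟩
    count (λ i → D (punchIn t i) t ∧ D′ i v)  ≡⟨ count-cong (λ i → cong (_∧ D′ i v) (to T-≡ (⟶t i))) ⟩
    inDegree D′ v                             ∎
    where open ≡-Reasoning

  commonOut-receiver : ∀ u → commonOut D t u ≡ 0
  commonOut-receiver u = count-none (λ w → t↛ w ∘ proj₁ ∘ to T-∧)

  quadrangularPair-punchIn⇔ : ∀ u v → QuadrangularPair D (punchIn t u) (punchIn t v) ⇔
                                       (commonOut D′ u v ≢ 0 × commonIn D′ u v ≢ 1)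
  quadrangularPair-punchIn⇔ u v = mk⇔
    (λ (out≢1 , in≢1) → out≢1 ∘ trans (commonOut-punchIn u v) ∘ cong suc
                      , in≢1 ∘ trans (commonIn-punchIn u v))
    (λ (out≢0 , in≢1) → out≢0 ∘ suc-injective ∘ trans (sym (commonOut-punchIn u v))
                      , in≢1 ∘ trans (sym (commonIn-punchIn u v)))

  quadrangularPair-receiver⇔ : ∀ v → QuadrangularPair D t (punchIn t v) ⇔ inDegree D′ v ≢ 1
  quadrangularPair-receiver⇔ v = mk⇔
    (λ (_ , in≢1) → in≢1 ∘ trans (commonIn-receiver v))
    (λ in≢1 → 0≢1+n ∘ trans (sym (commonOut-receiver (punchIn t v)))
            , in≢1 ∘ trans (sym (commonIn-receiver v)))

  inDegree≡0⇒transmitter : ∀ v → inDegree D′ v ≡ 0 → IsTransmitter D (punchIn t v)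
  inDegree≡0⇒transmitter v in≡0 u u≢v with ≡-or-punchIn t u
  ... | inj₁ refl = ⟶t v
  ... | inj₂ (i , refl) with total (punchIn t i) (punchIn t v) u≢v
  ...   | inj₁ i⟶v = contradiction in≡0 (count≢0 (λ w → D′ w v) i i⟶v)
  ...   | inj₂ v⟶i = v⟶i

  quadrangular⇒γ>2-dual×inQuadrangular×δ⁻≥2 :
    Fin n → ¬ (∃ λ v → IsTransmitter D v) → IsQuadrangular D →
    γ> (dual D′) 2 × IsInQuadrangular D′ × δ⁻≥ D′ 2
  quadrangular⇒γ>2-dual×inQuadrangular×δ⁻≥2 a ∄transmitter quad =
    commonOut≢0⇒γ>2-dual tour′ a in≢0 (λ u v → proj₁ ∘ pair u v) ,
    (λ u v → proj₂ ∘ pair u v) ,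
    (λ v → ≤∧≢⇒< (n≢0⇒n>0 (in≢0 v)) (≢-sym (in≢1 v)))
    where
    pair : ∀ u v → u ≢ v → commonOut D′ u v ≢ 0 × commonIn D′ u v ≢ 1
    pair u v u≢v = to (quadrangularPair-punchIn⇔ u v) (quad _ _ (u≢v ∘ punchIn-injective t u v))
    in≢0 : ∀ v → inDegree D′ v ≢ 0
    in≢0 v = ∄transmitter ∘ (punchIn t v ,_) ∘ inDegree≡0⇒transmitter v
    in≢1 : ∀ v → inDegree D′ v ≢ 1
    in≢1 v = to (quadrangularPair-receiver⇔ v) (quad t _ (≢-sym (punchInᵢ≢i t v)))

  γ>2-dual×inQuadrangular×δ⁻≥2⇒quadrangular :
    γ> (dual D′) 2 × IsInQuadrangular D′ × δ⁻≥ D′ 2 → IsQuadrangular D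
  γ>2-dual×inQuadrangular×δ⁻≥2⇒quadrangular (γ>2 , inQuad , δ⁻≥2) = quad
    where
    receiver-pair : ∀ v → QuadrangularPair D t (punchIn t v)
    receiver-pair v = from (quadrangularPair-receiver⇔ v) (>⇒≢ (δ⁻≥2 v))
    quad : IsQuadrangular D
    quad u v u≢v with ≡-or-punchIn t u | ≡-or-punchIn t v
    ... | inj₁ refl       | inj₁ refl       = contradiction refl u≢v
    ... | inj₁ refl       | inj₂ (j , refl) = receiver-pair j
    ... | inj₂ (i , refl) | inj₁ refl       = quadrangularPair-comm D (receiver-pair i)
    ... | inj₂ (i , refl) | inj₂ (j , refl) =
      from (quadrangularPair-punchIn⇔ i j)
           (γ>2-dual⇒commonOut≢0 tour′ γ>2 i j , inQuad i j (u≢v ∘ cong (punchIn t)))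

corollary3 : ∀ {n : ℕ} (D : Digraph (suc n)) (t : Fin (suc n))
             → IsTournament D → IsReceiver D t → ¬ (∃ λ v → IsTransmitter D v)
             → IsQuadrangular D
                 ⇔ (γ> (dual (deleteVertex D t)) 2
                    × IsInQuadrangular (deleteVertex D t)
                    × δ⁻≥ (deleteVertex D t) 2)
corollary3 {zero}  D zero tour rec ∄transmitter =
  contradiction (zero , λ { zero 0≢0 → contradiction refl 0≢0 }) ∄transmitter
corollary3 {suc n} D t    tour rec ∄transmitter = mk⇔
  (quadrangular⇒γ>2-dual×inQuadrangular×δ⁻≥2 tour rec zero ∄transmitter)
  (γ>2-dual×inQuadrangular×δ⁻≥2⇒quadrangular tour rec)
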